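{- Let $G$ be a graph of order $n$. Then the following are equivalent: (1) every non-trivial connected component of $G$ is a corona; (2) $\gamma_{\rm cer}(G)=n$; (3) $\Gamma_{\rm cer}(G)=n$.
   Context: All graphs are finite and simple; a non-trivial component is one with at least two vertices. A graph is a corona if it is isomorphic to $H\circ K_1$ for some graph $H$, i.e., obtained from $H$ by attaching one pendant vertex to each vertex of $H$. A dominating set of $G$ is a set $D\subseteq V_G$ such that every vertex of $V_G-D$ has a neighbor in $D$. A certified dominating set is a dominating set $D$ such that every vertex in $D$ has either zero or at least two neighbors in $V_G-D$. $\gamma_{\rm cer}(G)$ is the minimum cardinality of a certified dominating set, and $\Gamma_{\rm cer}(G)$ is the maximum cardinality of a minimal (with respect to inclusion) certified dominating set of $G$. -}

module Defs where

open import Data.Nat using (ℕ; _≤_; _+_)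
open import Data.Bool using (Bool; true; false; T)
open import Data.Fin using (Fin)
open import Data.Fin.Properties using (_≟_)
open import Data.Fin.Subset using (Subset; _∈_; _∉_; _⊆_; ∣_∣; ⊤)
open import Data.Sum using (_⊎_; inj₁; inj₂)
open import Data.Product using (Σ; ∃; ∃-syntax; _×_; _,_)
open import Relation.Nullary using (¬_; does)
open import Relation.Binary.PropositionalEquality using (_≡_)

-- A finite simple graph on the vertex set Fin n (so n is its order):
-- decidable (Bool-valued) adjacency, symmetric and loopless.
record Graph (n : ℕ) : Set where
  field
    adj    : Fin n → Fin n → Bool
    sym    : ∀ u v → adj u v ≡ adj v u
    irrefl : ∀ v → adj v v ≡ false

open Graph public

Adj : ∀ {n} → Graph n → Fin n → Fin n → Set
Adj G u v = T (adj G u v)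

Dominating : ∀ {n} → Graph n → Subset n → Set
Dominating G D = ∀ v → v ∉ D → ∃[ u ] (u ∈ D × Adj G u v)

NoOutsideNeighbour : ∀ {n} → Graph n → Subset n → Fin n → Set
NoOutsideNeighbour G D v = ∀ u → u ∉ D → ¬ Adj G v u

TwoOutsideNeighbours : ∀ {n} → Graph n → Subset n → Fin n → Set
TwoOutsideNeighbours G D v =
  ∃[ u ] ∃[ w ] (¬ u ≡ w × u ∉ D × w ∉ D × Adj G v u × Adj G v w)

Certified : ∀ {n} → Graph n → Subset n → Set
Certified G D =
  Dominating G D ×
  (∀ v → v ∈ D → NoOutsideNeighbour G D v ⊎ TwoOutsideNeighbours G D v)

MinimalCertified : ∀ {n} → Graph n → Subset n → Set
MinimalCertified G D =
  Certified G D × (∀ D′ → D′ ⊆ D → Certified G D′ → D′ ≡ D)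

γcer≡ : ∀ {n} → Graph n → ℕ → Set
γcer≡ G k =
  (∃[ D ] (Certified G D × ∣ D ∣ ≡ k)) × (∀ D → Certified G D → k ≤ ∣ D ∣)

Γcer≡ : ∀ {n} → Graph n → ℕ → Set
Γcer≡ G k =
  (∃[ D ] (MinimalCertified G D × ∣ D ∣ ≡ k)) ×
  (∀ D → MinimalCertified G D → ∣ D ∣ ≤ k)

data Reach {n} (G : Graph n) (u : Fin n) : Fin n → Set where
  here : Reach G u u
  step : ∀ {v w} → Reach G u v → Adj G v w → Reach G u w

NontrivialComponent : ∀ {n} → Graph n → Fin n → Set
NontrivialComponent G u = ∃[ v ] (¬ v ≡ u × Reach G u v)

-- adjacency of the corona H ∘ K₁ on vertex set Fin m ⊎ Fin m:
-- inj₁ x are the vertices of H, inj₂ x is the pendant vertex attached to x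
coronaAdj : ∀ {m} → Graph m → Fin m ⊎ Fin m → Fin m ⊎ Fin m → Bool
coronaAdj H (inj₁ x) (inj₁ y) = adj H x y
coronaAdj H (inj₁ x) (inj₂ y) = does (x ≟ y)
coronaAdj H (inj₂ x) (inj₁ y) = does (x ≟ y)
coronaAdj H (inj₂ x) (inj₂ y) = false

-- The subgraph of G induced by the connected component of u is isomorphic
-- to H ∘ K₁ for some (finite simple) graph H: f is an injection from the
-- vertices of H ∘ K₁ onto the component of u, preserving and reflecting
-- adjacency.
ComponentIsCorona : ∀ {n} → Graph n → Fin n → Set
ComponentIsCorona {n} G u =
  ∃[ m ] Σ (Graph m) λ H → Σ (Fin m ⊎ Fin m → Fin n) λ f →
    (∀ x y → f x ≡ f y → x ≡ y) ×
    (∀ x → Reach G u (f x)) ×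
    (∀ v → Reach G u v → ∃[ x ] (f x ≡ v)) ×
    (∀ x y → adj G (f x) (f y) ≡ coronaAdj H x y)

NontrivialComponentsAreCoronas : ∀ {n} → Graph n → Set
NontrivialComponentsAreCoronas G =
  ∀ u → NontrivialComponent G u → ComponentIsCorona G u

-- Both γcer(G) = n and Γcer(G) = n say that the whole vertex set V is the only certified
-- dominating set of G. In a corona every vertex lies in every certified dominating set D:
-- if a support vertex were outside D, its leaf would be undominated or would have exactly
-- one neighbour outside D, and if a leaf were outside D, its support would have exactly
-- one neighbour outside D.
-- Conversely, suppose V is the only certified dominating set. No vertex carries two leaves,
-- since the complement of two leaves at one vertex is certified. Call a vertex leafless if
-- it has two neighbours but no leaf. There is none: otherwise take a maximal independent
-- set I of the leafless vertices not adjacent to a support vertex, and remove the leafless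
-- vertices outside I together with the leaves of supports adjacent to a leafless vertex;
-- what remains is a proper certified dominating set. Hence every nontrivial component is
-- the corona of its vertices with two neighbours, or is K₂.

module Submission where

open import Defs hiding (sym)
open import Data.Bool using (T; true; false)
open import Data.Bool.Properties using (T-≡)
open import Data.Empty using (⊥-elim)
open import Data.Fin using (Fin; zero; suc)
open import Data.Fin.Properties using (_≟_; any?; all?)
open import Data.Fin.Subset
  using (Subset; _∈_; _∉_; _⊆_; _⊃_; ∣_∣; ⊤; ⁅_⁆; _∪_) renaming (⊥ to ∅)
open import Data.Fin.Subset.Properties
  using (_∈?_; _⊂?_; ∈⊤; ⊆⊤; ⊆-antisym; ∉⊥; ∣⊤∣≡n; ∣p∣≡n⇒p≡⊤; ∣p∣≤n;
         x∈⁅x⁆; x∈⁅y⁆⇒x≡y; x∈p∪q⁺; x∈p∪q⁻)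
open import Data.Fin.Subset.Induction using (Acc; acc; ⊃-wellFounded)
open import Data.List using (List; []; _∷_; allFin; filter; length; lookup)
open import Data.List.Membership.Propositional using () renaming (_∈_ to _∈ₗ_)
open import Data.List.Membership.Propositional.Properties
  using (∈-allFin; ∈-filter⁺; ∈-filter⁻; ∈-lookup)
open import Data.List.Relation.Unary.All as All using ()
open import Data.List.Relation.Unary.Any using (here; there; index)
open import Data.List.Relation.Unary.Any.Properties using (lookup-index)
open import Data.List.Relation.Unary.Unique.Propositional using (Unique; _∷_)
open import Data.List.Relation.Unary.Unique.Propositional.Properties
  using (allFin⁺; filter⁺)
open import Data.Nat using (ℕ)
open import Data.Nat.Properties using (≤-antisym; ≤-reflexive)
open import Data.Product using (Σ; ∃; ∃-syntax; _×_; _,_; proj₁; proj₂)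
open import Data.Sum using (_⊎_; inj₁; inj₂; [_,_])
import Data.Sum as Sum
open import Data.Vec using (tabulate)
open import Data.Vec.Properties using ([]=⇒lookup; lookup⇒[]=; lookup∘tabulate)
open import Function using (_∘_)
open import Function.Bundles using (_⇔_; mk⇔; Equivalence)
open import Function.Construct.Composition using (_⇔-∘_)
open import Function.Construct.Symmetry using (⇔-sym)
open import Relation.Nullary using (¬_; Dec; yes; no; does; contradiction)
open import Relation.Nullary.Decidable
  using (dec-true; dec-false; decidable-stable; map; _×-dec_; _⊎-dec_; _→-dec_; ¬?; T?)
open import Relation.Unary using (Decidable)
open import Relation.Binary.PropositionalEquality
  using (_≡_; _≢_; refl; sym; trans; cong; subst)

subsetOf : ∀ {n} {P : Fin n → Set} → Decidable P → Subset n
subsetOf P? = tabulate (λ x → does (P? x))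

module _ {n} {P : Fin n → Set} (P? : Decidable P) where

  ∈-subsetOf⁺ : ∀ {x} → P x → x ∈ subsetOf P?
  ∈-subsetOf⁺ {x} px = lookup⇒[]= x _ (trans (lookup∘tabulate _ x) (dec-true (P? x) px))

  ∈-subsetOf⁻ : ∀ {x} → x ∈ subsetOf P? → P x
  ∈-subsetOf⁻ {x} x∈ = decidable-stable (P? x) λ ¬px →
    contradiction (trans (sym (dec-false (P? x) ¬px)) does≡true) λ ()
    where
    does≡true : does (P? x) ≡ true
    does≡true = trans (sym (lookup∘tabulate _ x)) ([]=⇒lookup x∈)

lookup-injective : ∀ {a} {A : Set a} {xs : List A} → Unique xs →
                   ∀ i j → lookup xs i ≡ lookup xs j → i ≡ j
lookup-injective (_ ∷ _)      zero    zero    _  = refl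
lookup-injective (x∉xs ∷ _)   zero    (suc j) eq = contradiction eq (All.lookup x∉xs (∈-lookup j))
lookup-injective (x∉xs ∷ _)   (suc i) zero    eq = contradiction (sym eq) (All.lookup x∉xs (∈-lookup i))
lookup-injective (_ ∷ unique) (suc i) (suc j) eq = cong suc (lookup-injective unique i j eq)

T⇒≡true : ∀ {b} → T b → b ≡ true
T⇒≡true = Equivalence.to T-≡

¬T⇒≡false : ∀ {b} → ¬ T b → b ≡ false
¬T⇒≡false {false} _  = refl
¬T⇒≡false {true}  ¬t = contradiction _ ¬t

x∈p∪⁅y⁆⁻ : ∀ {n} {x y : Fin n} (p : Subset n) → x ∈ p ∪ ⁅ y ⁆ → x ∈ p ⊎ x ≡ y
x∈p∪⁅y⁆⁻ p = Sum.map₂ (x∈⁅y⁆⇒x≡y _) ∘ x∈p∪q⁻ p _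

Enumeration : ∀ {n} → (Fin n → Set) → Set
Enumeration {n} P = ∃[ m ] Σ (Fin m → Fin n) λ e →
  (∀ i j → e i ≡ e j → i ≡ j) × (∀ i → P (e i)) × (∀ v → P v → ∃[ i ] (e i ≡ v))

enumerate : ∀ {n} {P : Fin n → Set} → Decidable P → Enumeration P
enumerate {n} P? =
  length xs , lookup xs ,
  lookup-injective (filter⁺ P? (allFin⁺ n)) ,
  (λ i → proj₂ (∈-filter⁻ P? {xs = allFin n} (∈-lookup i))) ,
  λ v pv → let v∈xs = ∈-filter⁺ P? (∈-allFin v) pv in index v∈xs , sym (lookup-index v∈xs)
  where xs = filter P? (allFin n)

module _ {n} (F : Subset n → Subset n) (F-inflationary : ∀ {p} → p ⊆ F p)
         (Inv : Subset n → Set) (F-preserves : ∀ {p} → Inv p → Inv (F p)) where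

  invariantFixedPoint : ∀ {p} → Inv p → ∃[ q ] (Inv q × F q ⊆ q)
  invariantFixedPoint = iterate (⊃-wellFounded _)
    where
    iterate : ∀ {p} → Acc _⊃_ p → Inv p → ∃[ q ] (Inv q × F q ⊆ q)
    iterate {p} (acc rec) inv with p ⊂? F p
    ... | yes p⊂Fp = iterate (rec p⊂Fp) (F-preserves inv)
    ... | no  p⊄Fp = p , inv , Fp⊆p
      where
      Fp⊆p : F p ⊆ p
      Fp⊆p {x} x∈Fp = decidable-stable (x ∈? p) λ x∉p → p⊄Fp (F-inflationary , x , x∈Fp , x∉p)

module _ {m} (H : Graph m) where

  coronaAdj-pendant : ∀ z → T (coronaAdj H (inj₂ z) (inj₁ z))
  coronaAdj-pendant z with z ≟ z
  ... | yes _   = _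
  ... | no  z≢z = z≢z refl

  coronaAdj-pendant⁻ : ∀ z y → T (coronaAdj H (inj₂ z) y) → y ≡ inj₁ z
  coronaAdj-pendant⁻ z (inj₁ z′) t with z ≟ z′
  ... | yes refl = refl
  ... | no  _    = ⊥-elim t
  coronaAdj-pendant⁻ z (inj₂ _) ()

  coronaAdj-support⁻ : ∀ z z′ → T (coronaAdj H (inj₁ z) (inj₂ z′)) → z ≡ z′
  coronaAdj-support⁻ z z′ t with z ≟ z′
  ... | yes z≡z′ = z≡z′
  ... | no  _    = ⊥-elim t

module _ {n} (G : Graph n) where

  Adj? : ∀ u v → Dec (Adj G u v)
  Adj? u v = T? (adj G u v)

  adj-sym : ∀ {u v} → Adj G u v → Adj G v u
  adj-sym {u} {v} = subst T (Graph.sym G u v)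

  adj⇒≢ : ∀ {u v} → Adj G u v → u ≢ v
  adj⇒≢ {v = v} a refl = subst T (irrefl G v) a

  reach⇒≡⊎neighbour : ∀ {u v} → Reach G u v → v ≡ u ⊎ ∃ (Adj G u)
  reach⇒≡⊎neighbour here       = inj₁ refl
  reach⇒≡⊎neighbour (step r a) with reach⇒≡⊎neighbour r
  ... | inj₁ refl = inj₂ (_ , a)
  ... | inj₂ u-a  = inj₂ u-a

  Expansion : Subset n → Fin n → Set
  Expansion p w = w ∈ p ⊎ ∃[ v ] (v ∈ p × Adj G v w)

  expansion? : ∀ p → Decidable (Expansion p)
  expansion? p w = w ∈? p ⊎-dec any? (λ v → v ∈? p ×-dec Adj? v w)

  expand : Subset n → Subset n
  expand p = subsetOf (expansion? p)

  module _ (u : Fin n) where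

    ReachedFrom : Subset n → Set
    ReachedFrom p = u ∈ p × (∀ {v} → v ∈ p → Reach G u v)

    expand-reachedFrom : ∀ {p} → ReachedFrom p → ReachedFrom (expand p)
    expand-reachedFrom {p} (u∈p , reached) = ∈-subsetOf⁺ (expansion? p) (inj₁ u∈p) , λ v∈ →
      [ reached , (λ (w , w∈p , wv) → step (reached w∈p) wv) ] (∈-subsetOf⁻ (expansion? p) v∈)

    reachedFrom-⁅⁆ : ReachedFrom ⁅ u ⁆
    reachedFrom-⁅⁆ = x∈⁅x⁆ u , λ v∈ → subst (Reach G u) (sym (x∈⁅y⁆⇒x≡y u v∈)) here

    reachableSet : ∃[ q ] (∀ {v} → v ∈ q ⇔ Reach G u v)
    reachableSet with invariantFixedPoint expand (λ {p} → ∈-subsetOf⁺ (expansion? p) ∘ inj₁)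
                        ReachedFrom expand-reachedFrom reachedFrom-⁅⁆
    ... | q , (u∈q , reached) , closed = q , mk⇔ reached complete
      where
      complete : ∀ {v} → Reach G u v → v ∈ q
      complete here       = u∈q
      complete (step r a) = closed (∈-subsetOf⁺ (expansion? q) (inj₂ (_ , complete r , a)))

  reach? : ∀ u v → Dec (Reach G u v)
  reach? u v = map (proj₂ (reachableSet u)) (v ∈? proj₁ (reachableSet u))

  LeafOf : Fin n → Fin n → Set
  LeafOf p l = Adj G l p × (∀ y → Adj G l y → y ≡ p)

  Leaf : Fin n → Set
  Leaf l = ∃[ p ] LeafOf p l

  HasLeaf : Fin n → Set
  HasLeaf p = ∃[ l ] LeafOf p l

  HasTwoNeighbours : Fin n → Set
  HasTwoNeighbours v = ∃[ a ] ∃[ b ] (a ≢ b × Adj G v a × Adj G v b)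

  leafOf? : ∀ p l → Dec (LeafOf p l)
  leafOf? p l = Adj? l p ×-dec all? (λ y → Adj? l y →-dec y ≟ p)

  hasLeaf? : ∀ p → Dec (HasLeaf p)
  hasLeaf? p = any? (leafOf? p)

  hasTwoNeighbours? : ∀ v → Dec (HasTwoNeighbours v)
  hasTwoNeighbours? v = any? λ a → any? λ b → ¬? (a ≟ b) ×-dec Adj? v a ×-dec Adj? v b

  leafOf-adj : ∀ {p l} → LeafOf p l → Adj G p l
  leafOf-adj = adj-sym ∘ proj₁

  leafOf-neighbour : ∀ {p l y} → LeafOf p l → Adj G y l → y ≡ p
  leafOf-neighbour (_ , only-p) yl = only-p _ (adj-sym yl)

  leaf⇒¬hasTwoNeighbours : ∀ {v} → Leaf v → ¬ HasTwoNeighbours v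
  leaf⇒¬hasTwoNeighbours (_ , _ , only-p) (a , b , a≢b , va , vb) =
    a≢b (trans (only-p a va) (sym (only-p b vb)))

  leaf⊎hasTwoNeighbours : ∀ {v a} → Adj G v a → Leaf v ⊎ HasTwoNeighbours v
  leaf⊎hasTwoNeighbours {v} {a} va with any? (λ y → Adj? v y ×-dec ¬? (y ≟ a))
  ... | yes (y , vy , y≢a) = inj₂ (y , a , y≢a , vy , va)
  ... | no  ¬other         =
    inj₁ (a , va , λ y vy → decidable-stable (y ≟ a) λ y≢a → ¬other (y , vy , y≢a))

  OnlyVertexSetCertified : Set
  OnlyVertexSetCertified = ∀ D → Certified G D → D ≡ ⊤

  ⊤-certified : Certified G ⊤
  ⊤-certified = (λ _ v∉⊤ → contradiction ∈⊤ v∉⊤) , λ _ _ → inj₁ λ _ u∉⊤ _ → u∉⊤ ∈⊤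

  γcer≡n⇔onlyVertexSetCertified : γcer≡ G n ⇔ OnlyVertexSetCertified
  γcer≡n⇔onlyVertexSetCertified = mk⇔
    (λ (_ , minimum) D cert → ∣p∣≡n⇒p≡⊤ (≤-antisym (∣p∣≤n D) (minimum D cert)))
    (λ only → (⊤ , ⊤-certified , ∣⊤∣≡n n) ,
              λ D cert → ≤-reflexive (sym (trans (cong ∣_∣ (only D cert)) (∣⊤∣≡n n))))

  Γcer≡n⇔onlyVertexSetCertified : Γcer≡ G n ⇔ OnlyVertexSetCertified
  Γcer≡n⇔onlyVertexSetCertified = mk⇔
    (λ ((D₀ , (_ , minimal) , ∣D₀∣≡n) , _) D cert →
       let D₀≡⊤ = ∣p∣≡n⇒p≡⊤ ∣D₀∣≡n in
       trans (minimal D (subst (D ⊆_) (sym D₀≡⊤) ⊆⊤) cert) D₀≡⊤)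
    (λ only → (⊤ , (⊤-certified , λ D _ cert → only D cert) , ∣⊤∣≡n n) , λ D _ → ∣p∣≤n D)

  CertifiedRemoval : (Fin n → Set) → Set
  CertifiedRemoval S =
    (∀ v → S v → ∃[ u ] (¬ S u × Adj G u v)) ×
    (∀ v → ¬ S v → (∀ u → S u → ¬ Adj G v u) ⊎
                   ∃[ a ] ∃[ b ] (a ≢ b × S a × S b × Adj G v a × Adj G v b))

  module _ {S : Fin n → Set} (S? : Decidable S) where

    complementOf : Subset n
    complementOf = subsetOf (¬? ∘ S?)

    ∉-complementOf : ∀ {v} → v ∉ complementOf → S v
    ∉-complementOf {v} v∉ = decidable-stable (S? v) (v∉ ∘ ∈-subsetOf⁺ (¬? ∘ S?))

    certifiedRemoval⇒certified : CertifiedRemoval S → Certified G complementOf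
    certifiedRemoval⇒certified (dominated , certified) =
      (λ v v∉ → let (u , ¬Su , uv) = dominated v (∉-complementOf v∉) in
                u , ∈-subsetOf⁺ (¬? ∘ S?) ¬Su , uv) ,
      λ v v∈ → [ (λ none → inj₁ λ u u∉ → none u (∉-complementOf u∉)) ,
                 (λ (a , b , a≢b , Sa , Sb , va , vb) →
                    inj₂ (a , b , a≢b , ∉S Sa , ∉S Sb , va , vb)) ]
               (certified v (∈-subsetOf⁻ (¬? ∘ S?) v∈))
      where
      ∉S : ∀ {v} → S v → v ∉ complementOf
      ∉S Sv v∈ = ∈-subsetOf⁻ (¬? ∘ S?) v∈ Sv

    certifiedRemoval-empty : OnlyVertexSetCertified → CertifiedRemoval S → ∀ v → ¬ S v
    certifiedRemoval-empty only removal v =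
      ∈-subsetOf⁻ (¬? ∘ S?) (subst (v ∈_) (sym (only _ (certifiedRemoval⇒certified removal))) ∈⊤)

  twoOutside⇒hasTwoNeighbours : ∀ {D v} → TwoOutsideNeighbours G D v → HasTwoNeighbours v
  twoOutside⇒hasTwoNeighbours (a , b , a≢b , _ , _ , va , vb) = a , b , a≢b , va , vb

  leafOf⇒support∈ : ∀ {D p l} → Certified G D → LeafOf p l → p ∈ D
  leafOf⇒support∈ {D} {p} {l} (dominating , certified) L@(lp , _) with p ∈? D | l ∈? D
  ... | yes p∈D | _       = p∈D
  ... | no  p∉D | no  l∉D = let (u , u∈D , ul) = dominating l l∉D in
                            contradiction (subst (_∈ D) (leafOf-neighbour L ul) u∈D) p∉D
  ... | no  p∉D | yes l∈D with certified l l∈D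
  ...   | inj₁ none = contradiction lp (none p p∉D)
  ...   | inj₂ two  = contradiction (twoOutside⇒hasTwoNeighbours two) (leaf⇒¬hasTwoNeighbours (p , L))

  leafOf⇒leaf∈ : ∀ {D p l} → Certified G D → LeafOf p l →
                 (∀ w → Adj G p w → w ≢ l → w ∈ D) → l ∈ D
  leafOf⇒leaf∈ {D} {p} {l} cert@(_ , certified) L others with l ∈? D
  ... | yes l∈D = l∈D
  ... | no  l∉D with certified p (leafOf⇒support∈ cert L)
  ...   | inj₁ none = contradiction (leafOf-adj L) (none l l∉D)
  ...   | inj₂ (a , b , a≢b , a∉D , b∉D , pa , pb) =
    contradiction (trans (≡l a∉D pa) (sym (≡l b∉D pb))) a≢b
    where
    ≡l : ∀ {w} → w ∉ D → Adj G p w → w ≡ l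
    ≡l {w} w∉D pw = decidable-stable (w ≟ l) (w∉D ∘ others w pw)

  module CoronaComponent {u m} (H : Graph m) (f : Fin m ⊎ Fin m → Fin n)
    (f-reach : ∀ x → Reach G u (f x)) (f-onto : ∀ v → Reach G u v → ∃[ x ] (f x ≡ v))
    (f-adj : ∀ x y → adj G (f x) (f y) ≡ coronaAdj H x y) where

    neighbour-image : ∀ x {w} → Adj G (f x) w → ∃[ y ] (f y ≡ w × T (coronaAdj H x y))
    neighbour-image x xw with f-onto _ (step (f-reach x) xw)
    ... | y , refl = y , refl , subst T (f-adj x y) xw

    pendant-leafOf : ∀ z → LeafOf (f (inj₁ z)) (f (inj₂ z))
    pendant-leafOf z = subst T (sym (f-adj (inj₂ z) (inj₁ z))) (coronaAdj-pendant H z) , only-support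
      where
      only-support : ∀ w → Adj G (f (inj₂ z)) w → w ≡ f (inj₁ z)
      only-support w zw with neighbour-image (inj₂ z) zw
      ... | y , refl , t = cong f (coronaAdj-pendant⁻ H z y t)

    support-neighbour : ∀ z w → Adj G (f (inj₁ z)) w → w ≢ f (inj₂ z) → ∃[ z′ ] (f (inj₁ z′) ≡ w)
    support-neighbour z w zw w≢ with neighbour-image (inj₁ z) zw
    ... | inj₁ z′ , refl , _ = z′ , refl
    ... | inj₂ z′ , refl , t = contradiction (cong (f ∘ inj₂) (sym (coronaAdj-support⁻ H z z′ t))) w≢

    certified-covers : ∀ {D} → Certified G D → ∀ x → f x ∈ D
    certified-covers cert (inj₁ z) = leafOf⇒support∈ cert (pendant-leafOf z)
    certified-covers {D} cert (inj₂ z) = leafOf⇒leaf∈ cert (pendant-leafOf z) λ w zw w≢ →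
      let (z′ , z′≡w) = support-neighbour z w zw w≢ in
      subst (_∈ D) z′≡w (certified-covers cert (inj₁ z′))

  corona⇒∈certified : ∀ {u D} → ComponentIsCorona G u → Certified G D → u ∈ D
  corona⇒∈certified (_ , H , f , _ , f-reach , f-onto , f-adj) cert with f-onto _ here
  ... | x , refl = CoronaComponent.certified-covers H f f-reach f-onto f-adj cert x

  coronas⇒onlyVertexSetCertified : NontrivialComponentsAreCoronas G → OnlyVertexSetCertified
  coronas⇒onlyVertexSetCertified coronas D cert@(dominating , _) = ⊆-antisym ⊆⊤ λ {v} _ →
    decidable-stable (v ∈? D) λ v∉D →
      let (u , u∈D , uv) = dominating v v∉D in
      v∉D (corona⇒∈certified (coronas v (u , adj⇒≢ uv , step here (adj-sym uv))) cert)

  twoLeaves-certifiedRemoval : ∀ {p l₁ l₂} → LeafOf p l₁ → LeafOf p l₂ → l₁ ≢ l₂ →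
                               CertifiedRemoval (λ v → v ≡ l₁ ⊎ v ≡ l₂)
  twoLeaves-certifiedRemoval {p} {l₁} {l₂} L₁ L₂ l₁≢l₂ = dominated , certified
    where
    p-kept : ¬ (p ≡ l₁ ⊎ p ≡ l₂)
    p-kept = [ adj⇒≢ (leafOf-adj L₁) , adj⇒≢ (leafOf-adj L₂) ]
    dominated : ∀ v → v ≡ l₁ ⊎ v ≡ l₂ → ∃[ u ] (¬ (u ≡ l₁ ⊎ u ≡ l₂) × Adj G u v)
    dominated _ (inj₁ refl) = p , p-kept , leafOf-adj L₁
    dominated _ (inj₂ refl) = p , p-kept , leafOf-adj L₂
    certified : ∀ v → ¬ (v ≡ l₁ ⊎ v ≡ l₂) →
                (∀ u → u ≡ l₁ ⊎ u ≡ l₂ → ¬ Adj G v u) ⊎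
                ∃[ a ] ∃[ b ] (a ≢ b × (a ≡ l₁ ⊎ a ≡ l₂) × (b ≡ l₁ ⊎ b ≡ l₂) × Adj G v a × Adj G v b)
    certified v _ with v ≟ p
    ... | yes refl = inj₂ (l₁ , l₂ , l₁≢l₂ , inj₁ refl , inj₂ refl , leafOf-adj L₁ , leafOf-adj L₂)
    ... | no  v≢p  = inj₁ λ where
      _ (inj₁ refl) vl₁ → v≢p (leafOf-neighbour L₁ vl₁)
      _ (inj₂ refl) vl₂ → v≢p (leafOf-neighbour L₂ vl₂)

  leafOf-unique : OnlyVertexSetCertified → ∀ {p l₁ l₂} → LeafOf p l₁ → LeafOf p l₂ → l₁ ≡ l₂
  leafOf-unique only {l₁ = l₁} {l₂} L₁ L₂ = decidable-stable (l₁ ≟ l₂) λ l₁≢l₂ →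
    certifiedRemoval-empty (λ v → v ≟ l₁ ⊎-dec v ≟ l₂) only
      (twoLeaves-certifiedRemoval L₁ L₂ l₁≢l₂) l₁ (inj₁ refl)

  Independent : Subset n → Set
  Independent I = ∀ {v w} → v ∈ I → w ∈ I → ¬ Adj G v w

  Dominated : Subset n → Fin n → Set
  Dominated I v = v ∈ I ⊎ ∃[ w ] (w ∈ I × Adj G w v)

  dominated? : ∀ I v → Dec (Dominated I v)
  dominated? I v = v ∈? I ⊎-dec any? (λ w → w ∈? I ×-dec Adj? w v)

  dominated-∪⁅⁆ : ∀ {I v w} → Dominated I w → Dominated (I ∪ ⁅ v ⁆) w
  dominated-∪⁅⁆ (inj₁ w∈I)           = inj₁ (x∈p∪q⁺ (inj₁ w∈I))
  dominated-∪⁅⁆ (inj₂ (u , u∈I , uw)) = inj₂ (u , x∈p∪q⁺ (inj₁ u∈I) , uw)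

  independent-∪⁅⁆ : ∀ {I v} → Independent I → ¬ Dominated I v → Independent (I ∪ ⁅ v ⁆)
  independent-∪⁅⁆ {I} {v} independent undominated x∈ y∈
    with x∈p∪⁅y⁆⁻ I x∈ | x∈p∪⁅y⁆⁻ I y∈
  ... | inj₁ x∈I  | inj₁ y∈I  = independent x∈I y∈I
  ... | inj₁ x∈I  | inj₂ refl = λ xv → undominated (inj₂ (_ , x∈I , xv))
  ... | inj₂ refl | inj₁ y∈I  = λ vy → undominated (inj₂ (_ , y∈I , adj-sym vy))
  ... | inj₂ refl | inj₂ refl = λ vv → adj⇒≢ vv refl

  maximalIndependentSet : ∀ {B : Fin n → Set} → Decidable B →
    ∃[ I ] ((∀ {v} → v ∈ I → B v) × Independent I × (∀ v → B v → Dominated I v))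
  maximalIndependentSet {B} B? =
    let (I , I⊆B , independent , dominates) = greedy (allFin n) in
    I , I⊆B , independent , λ v → dominates (∈-allFin v)
    where
    greedy : ∀ vs → ∃[ I ] ((∀ {v} → v ∈ I → B v) × Independent I ×
                            (∀ {v} → v ∈ₗ vs → B v → Dominated I v))
    greedy [] = ∅ , (λ v∈∅ → contradiction v∈∅ ∉⊥) , (λ v∈∅ → contradiction v∈∅ ∉⊥) , λ ()
    greedy (v ∷ vs) with greedy vs
    ... | I , I⊆B , independent , dominates with B? v ×-dec ¬? (dominated? I v)
    ...   | no  ¬[Bv×undominated] = I , I⊆B , independent , λ where
      (here refl) Bv → decidable-stable (dominated? I v) λ undominated →
                         ¬[Bv×undominated] (Bv , undominated)
      (there w∈vs)    → dominates w∈vs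
    ...   | yes (Bv , undominated) =
      I ∪ ⁅ v ⁆ ,
      (λ w∈ → [ I⊆B , (λ { refl → Bv }) ] (x∈p∪⁅y⁆⁻ I w∈)) ,
      independent-∪⁅⁆ independent undominated ,
      λ where
        (here refl)  _  → inj₁ (x∈p∪q⁺ (inj₂ (x∈⁅x⁆ v)))
        (there w∈vs) Bw → dominated-∪⁅⁆ (dominates w∈vs Bw)

  Leafless : Fin n → Set
  Leafless v = HasTwoNeighbours v × ¬ HasLeaf v

  leafless? : ∀ v → Dec (Leafless v)
  leafless? v = hasTwoNeighbours? v ×-dec ¬? (hasLeaf? v)

  AdjacentToSupport : Fin n → Set
  AdjacentToSupport v = ∃[ y ] (Adj G v y × HasLeaf y)

  adjacentToSupport? : ∀ v → Dec (AdjacentToSupport v)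
  adjacentToSupport? v = any? λ y → Adj? v y ×-dec hasLeaf? y

  RemoteLeafless : Fin n → Set
  RemoteLeafless v = Leafless v × ¬ AdjacentToSupport v

  remoteLeafless? : ∀ v → Dec (RemoteLeafless v)
  remoteLeafless? v = leafless? v ×-dec ¬? (adjacentToSupport? v)

  leafless⇒¬leaf : ∀ {v} → Leafless v → ¬ Leaf v
  leafless⇒¬leaf (two , _) leaf = leaf⇒¬hasTwoNeighbours leaf two

  hasTwoNeighbours-fromLeaf : ∀ {y l s} → LeafOf y l → Adj G y s → ¬ Leaf s → HasTwoNeighbours y
  hasTwoNeighbours-fromLeaf {y} {l} {s} L ys ¬leaf-s = l , s , l≢s , leafOf-adj L , ys
    where
    l≢s : l ≢ s
    l≢s refl = ¬leaf-s (y , L)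

  adjacentLeafless⇒hasTwoNeighbours : ∀ {d b} → Adj G d b → Leafless b → HasTwoNeighbours d
  adjacentLeafless⇒hasTwoNeighbours {d} {b} db (_ , ¬hasLeaf-b) with leaf⊎hasTwoNeighbours db
  ... | inj₁ (p , L@(_ , only-p)) =
    contradiction (d , subst (λ p → LeafOf p d) (sym (only-p b db)) L) ¬hasLeaf-b
  ... | inj₂ two = two

  module LeaflessRemoval (I : Subset n) (I-remote : ∀ {v} → v ∈ I → RemoteLeafless v)
    (I-independent : Independent I) (I-dominates : ∀ v → RemoteLeafless v → Dominated I v) where

    Removed : Fin n → Set
    Removed v = (Leafless v × v ∉ I) ⊎ ∃[ q ] (LeafOf q v × ∃[ b ] (Adj G q b × Leafless b))

    removed? : ∀ v → Dec (Removed v)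
    removed? v = (leafless? v ×-dec ¬? (v ∈? I)) ⊎-dec
                 any? (λ q → leafOf? q v ×-dec any? (λ b → Adj? q b ×-dec leafless? b))

    I-neighbour-removed : ∀ {v w} → v ∈ I → Adj G v w → Removed w
    I-neighbour-removed {v} {w} v∈I vw with I-remote v∈I | leaf⊎hasTwoNeighbours (adj-sym vw)
    ... | (_ , ¬hasLeaf-v) , _ | inj₁ (p , Lw) =
      contradiction (w , subst (λ p → LeafOf p w) (sym (leafOf-neighbour Lw vw)) Lw) ¬hasLeaf-v
    ... | _ , ¬adjacentToSupport | inj₂ two =
      inj₁ ((two , λ hasLeaf-w → ¬adjacentToSupport (w , vw , hasLeaf-w)) ,
            λ w∈I → I-independent v∈I w∈I vw)

    support-kept : ∀ {q} → HasLeaf q → HasTwoNeighbours q → ¬ Removed q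
    support-kept hasLeaf-q _   (inj₁ ((_ , ¬hasLeaf-q) , _)) = ¬hasLeaf-q hasLeaf-q
    support-kept _         two (inj₂ (q′ , Lq , _))          = leaf⇒¬hasTwoNeighbours (q′ , Lq) two

    I-kept : ∀ {w} → w ∈ I → ¬ Removed w
    I-kept w∈I (inj₁ (_ , w∉I))     = w∉I w∈I
    I-kept w∈I (inj₂ (q , Lw , _)) = leafless⇒¬leaf (proj₁ (I-remote w∈I)) (q , Lw)

    removed-dominated : ∀ v → Removed v → ∃[ u ] (¬ Removed u × Adj G u v)
    removed-dominated v (inj₁ (leafless-v , v∉I)) with adjacentToSupport? v
    ... | yes (y , vy , l , L) =
      y , support-kept (l , L) (hasTwoNeighbours-fromLeaf L (adj-sym vy) (leafless⇒¬leaf leafless-v)) ,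
      adj-sym vy
    ... | no ¬adjacentToSupport with I-dominates v (leafless-v , ¬adjacentToSupport)
    ...   | inj₁ v∈I              = contradiction v∈I v∉I
    ...   | inj₂ (w , w∈I , wv)   = w , I-kept w∈I , wv
    removed-dominated v (inj₂ (q , Lv , b , qb , leafless-b)) =
      q , support-kept (v , Lv) (hasTwoNeighbours-fromLeaf Lv qb (leafless⇒¬leaf leafless-b)) ,
      leafOf-adj Lv

    kept-certified : ∀ d → ¬ Removed d → (∀ y → Removed y → ¬ Adj G d y) ⊎
                     ∃[ a ] ∃[ b ] (a ≢ b × Removed a × Removed b × Adj G d a × Adj G d b)
    kept-certified d d-kept with d ∈? I
    ... | yes d∈I =
      let (a , b , a≢b , da , db) = proj₁ (proj₁ (I-remote d∈I)) in
      inj₂ (a , b , a≢b , I-neighbour-removed d∈I da , I-neighbour-removed d∈I db , da , db)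
    ... | no d∉I with any? (λ b → Adj? d b ×-dec leafless? b)
    ...   | no ¬leaflessNeighbour = inj₁ λ where
      y (inj₁ (leafless-y , _)) dy → ¬leaflessNeighbour (y , dy , leafless-y)
      y (inj₂ (q , Ly , b , qb , leafless-b)) dy →
        ¬leaflessNeighbour (b , subst (λ x → Adj G x b) (sym (leafOf-neighbour Ly dy)) qb , leafless-b)
    ...   | yes (b , db , leafless-b) with hasLeaf? d
    ...     | no ¬hasLeaf-d =
      contradiction (inj₁ ((adjacentLeafless⇒hasTwoNeighbours db leafless-b , ¬hasLeaf-d) , d∉I)) d-kept
    ...     | yes (l , L) =
      inj₂ (l , b , l≢b , inj₂ (d , L , b , db , leafless-b) , inj₁ (leafless-b , b∉I) ,
            leafOf-adj L , db)
      where
      l≢b : l ≢ b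
      l≢b refl = leafless⇒¬leaf leafless-b (d , L)
      b∉I : b ∉ I
      b∉I b∈I = proj₂ (I-remote b∈I) (d , adj-sym db , l , L)

    leafless⇒removed : ∀ {v} → Leafless v → ∃ Removed
    leafless⇒removed {v} leafless-v@((a , _ , _ , va , _) , _) with v ∈? I
    ... | yes v∈I = a , I-neighbour-removed v∈I va
    ... | no  v∉I = v , inj₁ (leafless-v , v∉I)

  hasTwoNeighbours⇒hasLeaf : OnlyVertexSetCertified → ∀ {v} → HasTwoNeighbours v → HasLeaf v
  hasTwoNeighbours⇒hasLeaf only {v} two = decidable-stable (hasLeaf? v) λ ¬hasLeaf-v →
    let (I , I-remote , I-independent , I-dominates) = maximalIndependentSet remoteLeafless?
        open LeaflessRemoval I I-remote I-independent I-dominates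
        (w , removed-w) = leafless⇒removed (two , ¬hasLeaf-v)
    in certifiedRemoval-empty removed? only (removed-dominated , kept-certified) w removed-w

  module _ {C : Fin n → Set} (C? : Decidable C) (u : Fin n)
    (core-hasLeaf : ∀ {c} → C c → HasLeaf c)
    (core-leafUnique : ∀ {c l l′} → C c → LeafOf c l → LeafOf c l′ → l ≡ l′)
    (leaf-notCore : ∀ {c l} → C c → LeafOf c l → ¬ C l)
    (covered : ∀ {v} → Reach G u v → C v ⊎ ∃[ c ] (C c × LeafOf c v)) where

    coreLeaves⇒componentIsCorona : ComponentIsCorona G u
    coreLeaves⇒componentIsCorona with enumerate (λ v → C? v ×-dec reach? u v)
    ... | m , e , e-injective , e-core , e-onto = m , H , f , f-injective , f-reach , f-onto , f-adj
      where
      core : ∀ i → C (e i)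
      core = proj₁ ∘ e-core

      leaf : Fin m → Fin n
      leaf i = proj₁ (core-hasLeaf (core i))

      leaf-leafOf : ∀ i → LeafOf (e i) (leaf i)
      leaf-leafOf i = proj₂ (core-hasLeaf (core i))

      H : Graph m
      H = record { adj    = λ i j → adj G (e i) (e j)
                 ; sym    = λ i j → Graph.sym G (e i) (e j)
                 ; irrefl = λ i → irrefl G (e i) }

      f : Fin m ⊎ Fin m → Fin n
      f (inj₁ i) = e i
      f (inj₂ i) = leaf i

      leaf≢core : ∀ i j → leaf i ≢ e j
      leaf≢core i j eq = leaf-notCore (core i) (leaf-leafOf i) (subst C (sym eq) (core j))

      f-injective : ∀ x y → f x ≡ f y → x ≡ y
      f-injective (inj₁ i) (inj₁ j) eq = cong inj₁ (e-injective i j eq)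
      f-injective (inj₁ i) (inj₂ j) eq = contradiction (sym eq) (leaf≢core j i)
      f-injective (inj₂ i) (inj₁ j) eq = contradiction eq (leaf≢core i j)
      f-injective (inj₂ i) (inj₂ j) eq =
        cong inj₂ (e-injective i j (sym (leafOf-neighbour (leaf-leafOf i)
          (subst (Adj G (e j)) (sym eq) (leafOf-adj (leaf-leafOf j))))))

      f-reach : ∀ x → Reach G u (f x)
      f-reach (inj₁ i) = proj₂ (e-core i)
      f-reach (inj₂ i) = step (proj₂ (e-core i)) (leafOf-adj (leaf-leafOf i))

      f-onto : ∀ v → Reach G u v → ∃[ x ] (f x ≡ v)
      f-onto v r with covered r
      ... | inj₁ Cv = let (i , ei≡v) = e-onto v (Cv , r) in inj₁ i , ei≡v
      ... | inj₂ (c , Cc , Lv) with e-onto c (Cc , step r (proj₁ Lv))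
      ...   | i , refl = inj₂ i , core-leafUnique Cc (leaf-leafOf i) Lv

      f-adj : ∀ x y → adj G (f x) (f y) ≡ coronaAdj H x y
      f-adj (inj₁ i) (inj₁ j) = refl
      f-adj (inj₁ i) (inj₂ j) with i ≟ j
      ... | yes refl = T⇒≡true (leafOf-adj (leaf-leafOf i))
      ... | no  i≢j  = ¬T⇒≡false λ ei-lj →
        i≢j (e-injective i j (leafOf-neighbour (leaf-leafOf j) ei-lj))
      f-adj (inj₂ i) (inj₁ j) with i ≟ j
      ... | yes refl = T⇒≡true (proj₁ (leaf-leafOf i))
      ... | no  i≢j  = ¬T⇒≡false λ li-ej →
        i≢j (e-injective i j (sym (leafOf-neighbour (leaf-leafOf i) (adj-sym li-ej))))
      f-adj (inj₂ i) (inj₂ j) = ¬T⇒≡false λ li-lj →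
        leaf≢core j i (leafOf-neighbour (leaf-leafOf i) (adj-sym li-lj))

  K₂-isCorona : ∀ {u p} → LeafOf p u → LeafOf u p → ComponentIsCorona G u
  K₂-isCorona {u} {p} Lu Lp =
    coreLeaves⇒componentIsCorona (_≟ u) u
      (λ { refl → p , Lp })
      (λ { refl L L′ → trans (leafOf-neighbour Lu (proj₁ L)) (sym (leafOf-neighbour Lu (proj₁ L′))) })
      (λ { refl L → adj⇒≢ (proj₁ L) })
      covered
    where
    covered : ∀ {v} → Reach G u v → v ≡ u ⊎ ∃[ c ] (c ≡ u × LeafOf c v)
    covered here = inj₁ refl
    covered (step r a) with covered r
    ... | inj₁ refl           =
      inj₂ (u , refl , subst (LeafOf u) (sym (leafOf-neighbour Lu (adj-sym a))) Lp)
    ... | inj₂ (_ , refl , L) = inj₁ (leafOf-neighbour L (adj-sym a))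

  CoreOrLeaf : Fin n → Set
  CoreOrLeaf v = HasTwoNeighbours v ⊎ ∃[ c ] (HasTwoNeighbours c × LeafOf c v)

  coreOrLeaf-step : ∀ {v w} → CoreOrLeaf v → Adj G v w → CoreOrLeaf w
  coreOrLeaf-step (inj₁ two) vw with leaf⊎hasTwoNeighbours (adj-sym vw)
  ... | inj₁ (p , Lw) = inj₂ (_ , two , subst (λ p → LeafOf p _) (sym (leafOf-neighbour Lw vw)) Lw)
  ... | inj₂ two-w    = inj₁ two-w
  coreOrLeaf-step (inj₂ (c , two , (_ , only-c))) vw =
    inj₁ (subst HasTwoNeighbours (sym (only-c _ vw)) two)

  coreOrLeaf-reach : ∀ {u v} → CoreOrLeaf u → Reach G u v → CoreOrLeaf v
  coreOrLeaf-reach cu here       = cu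
  coreOrLeaf-reach cu (step r a) = coreOrLeaf-step (coreOrLeaf-reach cu r) a

  coreOrLeaf⇒componentIsCorona : (∀ {v} → HasTwoNeighbours v → HasLeaf v) →
                                 (∀ {p l₁ l₂} → LeafOf p l₁ → LeafOf p l₂ → l₁ ≡ l₂) →
                                 ∀ {u} → CoreOrLeaf u → ComponentIsCorona G u
  coreOrLeaf⇒componentIsCorona hasLeaf leafUnique {u} cu =
    coreLeaves⇒componentIsCorona hasTwoNeighbours? u hasLeaf (λ _ → leafUnique)
      (λ _ L → leaf⇒¬hasTwoNeighbours (_ , L)) (coreOrLeaf-reach cu)

  pendantStructure⇒coronas : (∀ {v} → HasTwoNeighbours v → HasLeaf v) →
                             (∀ {p l₁ l₂} → LeafOf p l₁ → LeafOf p l₂ → l₁ ≡ l₂) →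
                             NontrivialComponentsAreCoronas G
  pendantStructure⇒coronas hasLeaf leafUnique u (v , v≢u , r) with reach⇒≡⊎neighbour r
  ... | inj₁ v≡u     = contradiction v≡u v≢u
  ... | inj₂ (_ , ua) with leaf⊎hasTwoNeighbours ua
  ...   | inj₂ two-u = coreOrLeaf⇒componentIsCorona hasLeaf leafUnique (inj₁ two-u)
  ...   | inj₁ (p , Lu) with leaf⊎hasTwoNeighbours (leafOf-adj Lu)
  ...     | inj₂ two-p       = coreOrLeaf⇒componentIsCorona hasLeaf leafUnique (inj₂ (p , two-p , Lu))
  ...     | inj₁ (_ , Lp@(_ , only-q)) =
    K₂-isCorona Lu (subst (λ q → LeafOf q p) (sym (only-q u (leafOf-adj Lu))) Lp)

  onlyVertexSetCertified⇒coronas : OnlyVertexSetCertified → NontrivialComponentsAreCoronas G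
  onlyVertexSetCertified⇒coronas only =
    pendantStructure⇒coronas (hasTwoNeighbours⇒hasLeaf only) (leafOf-unique only)

  coronas⇔onlyVertexSetCertified : NontrivialComponentsAreCoronas G ⇔ OnlyVertexSetCertified
  coronas⇔onlyVertexSetCertified =
    mk⇔ coronas⇒onlyVertexSetCertified onlyVertexSetCertified⇒coronas

theorem3p2 : (n : ℕ) (G : Graph n) →
    ((NontrivialComponentsAreCoronas G ⇔ γcer≡ G n) ×
     (γcer≡ G n ⇔ Γcer≡ G n))
theorem3p2 n G =
  ⇔-sym (γcer≡n⇔onlyVertexSetCertified G) ⇔-∘ coronas⇔onlyVertexSetCertified G ,
  ⇔-sym (Γcer≡n⇔onlyVertexSetCertified G) ⇔-∘ γcer≡n⇔onlyVertexSetCertified G
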